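{- Let $t\le k$ be positive integers and $n,s\ge0$ integers. The number of words $\pi\in[k]^n$ with $\mathrm{lev}_{[t]}(\pi)=s$ (i.e., with exactly $s$ levels whose first element lies in $[t]$) equals $$\sum_{m=0}^n\sum_{i=0}^m(-1)^{n-m-s}\binom{m}{i}\binom{i+n-m-1}{n-m}\binom{n-m}{s}(k-t)^{m-i}t^i.$$
   Context: $[k]=\{1,\ldots,k\}$, $[k]^n$ is the set of words of length $n$ over $[k]$. For a word $\pi=\pi_1\cdots\pi_n$ and $X\subseteq\mathbb{N}$, $\mathrm{lev}_X(\pi)=|\{i:\pi_i=\pi_{i+1},\ \pi_i\in X\}|$. Conventions: $\binom{a}{b}=\frac{a(a-1)\cdots(a-b+1)}{b!}$ for integers $b\ge0$ (so $\binom{ -1}{0}=1$), $\binom{a}{b}=0$ for $b<0$, and $0^0=1$. -}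

module Defs where

open import Data.Nat as ℕ using (ℕ; zero; suc; _∸_; _<ᵇ_; _!)
open import Data.Nat.Properties using (_!≢0)
open import Data.Bool using (Bool; true; false; _∧_; if_then_else_)
open import Data.Fin using (Fin; toℕ)
open import Data.Fin.Properties using (_≟_)
open import Data.Vec using (Vec; []; _∷_)
open import Data.Integer as ℤ using (ℤ; +_; -_; _+_; _-_; _*_; _^_)
open import Data.Integer.DivMod using (_/_)
open import Relation.Nullary.Decidable using (⌊_⌋)

-- A word of length n over [k] is a vector of letters in Fin k;
-- letter j ∈ Fin k stands for j+1 ∈ [k] = {1,…,k}, so
-- "letter ∈ [t]" means toℕ j < t.

levT : {k n : ℕ} → ℕ → Vec (Fin k) n → ℕ
levT t [] = 0
levT t (x ∷ []) = 0
levT t (x ∷ y ∷ w) =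
  (if ⌊ x ≟ y ⌋ ∧ (toℕ x <ᵇ t) then 1 else 0) ℕ.+ levT t (y ∷ w)

falling : ℤ → ℕ → ℤ
falling a zero = + 1
falling a (suc b) = a * falling (a - + 1) b

binom : ℤ → ℕ → ℤ
binom a b = (falling a b / (+ (b !))) {{b !≢0}}

sumTo : ℕ → (ℕ → ℤ) → ℤ
sumTo zero f = f 0
sumTo (suc n) f = sumTo n f + f (suc n)

-- the right-hand side of Theorem 3.1
-- (-1)^(n-m-s) is written as (-1)^((n-m)+s), which is equal for integer exponents
rhs : ℕ → ℕ → ℕ → ℕ → ℤ
rhs k t n s =
  sumTo n λ m → sumTo m λ i →
    ((- + 1) ^ ((n ∸ m) ℕ.+ s))
    * binom (+ m) i
    * binom (+ i + + (n ∸ m) - + 1) (n ∸ m)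
    * binom (+ (n ∸ m)) s
    * ((+ k - + t) ^ (m ∸ i))
    * ((+ t) ^ i)

-- Let a_n and b_n be the polynomials Σ x^lev(π) over the words π of length n + 1 with a
-- fixed first letter in [t], resp. over all words of length n, and u = k − t. Splitting off
-- the first letter gives a_{n+1} = (x + t − 1) a_n + u b_n and b_{n+1} = t a_n + u b_n.
-- In the variable w = x − 1 this system reads a_{n+1} = (w + t) a_n + u b_n,
-- b_{n+1} = t a_n + u b_n, and Pascal's rule shows that it is solved by
-- [w^j] b_{m+j} = Σ_i C(m,i) u^(m−i) t^i C(i+j−1, j) and the same with C(i+j, j) for a_{m+j}.
-- Substituting w = x − 1 back, i.e. expanding (x − 1)^j, gives the formula.
{-# OPTIONS --safe #-}
module Submission where

open import Defs
open import Algebra.Properties.CommutativeMonoid.Sum as Sum using ()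
open import Data.Bool using (Bool; true; false; _∧_; if_then_else_)
open import Data.Bool.Properties using (∧-identityʳ; ∧-zeroʳ)
open import Data.Fin using (Fin; zero; suc; toℕ)
open import Data.Fin.Properties using (_≟_; +↔⊎)
open import Data.Integer as ℤ using (ℤ; +_; -_; _+_; _-_; _*_; _^_; 0ℤ; 1ℤ)
import Data.Integer.Properties as ℤ
open import Data.Integer.DivMod using (_/_; div-pos-is-/ℕ)
open import Data.Integer.Tactic.RingSolver using (solve-∀)
open import Data.Nat as ℕ using (ℕ; zero; suc; _∸_; _<_; _≤_; _<ᵇ_; z≤n; s≤s; _!)
open import Data.Nat.Properties using (_!≢0)
import Data.Nat.Properties as ℕ
open import Data.Nat.Combinatorics using (_C_; nC1≡n; nCk+nC[k+1]≡[n+1]C[k+1]; k>n⇒nCk≡0; nCn≡1)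
open import Data.Nat.DivMod using (m*n/n≡m)
open import Data.Nat.Tactic.RingSolver using () renaming (solve-∀ to ℕ-solve-∀)
open import Data.Product using (Σ; _,_; _×_; ∃-syntax)
open import Data.Sum using (_⊎_; inj₁; inj₂)
open import Data.Sum.Function.Propositional using (_⊎-↔_)
open import Data.Vec using (Vec; []; _∷_)
open import Function.Bundles using (_↔_; mk↔ₛ′)
open import Function.Properties.Inverse using (↔-sym; ↔-trans)
open import Relation.Nullary using (contradiction)
open import Relation.Nullary.Decidable using (⌊_⌋; yes; no)
open import Relation.Binary.PropositionalEquality
  using (_≡_; refl; sym; trans; cong; cong₂; module ≡-Reasoning)

open Sum ℕ.+-0-commutativeMonoid using (sum)
open Sum ℤ.+-0-commutativeMonoid using () renaming (sum to sumℤ; sum-cong-≗ to sumℤ-cong)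

-- Sequences ℕ → A are coefficient sequences of generating functions;
-- shift z multiplies by the variable, z being the zero of A.
shift : {A : Set} → A → (ℕ → A) → ℕ → A
shift z c zero = z
shift z c (suc s) = c s

shift-cong : {A : Set} {z : A} {f g : ℕ → A} →
             (∀ s → f s ≡ g s) → ∀ s → shift z f s ≡ shift z g s
shift-cong e zero = refl
shift-cong e (suc s) = e s

pos-shift : {c : ℕ → ℕ} {f : ℕ → ℤ} →
            (∀ s → + c s ≡ f s) → ∀ s → + shift 0 c s ≡ shift 0ℤ f s
pos-shift e zero = refl
pos-shift e (suc s) = e s

δ : ℕ → ℕ
δ zero = 1
δ (suc _) = 0

Fibre : {A : Set} → (A → ℕ) → ℕ → Set
Fibre {A} f s = Σ A (λ a → f a ≡ s)

_HasFibreSizes_ : {A : Set} → (A → ℕ) → (ℕ → ℕ) → Set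
f HasFibreSizes c = ∀ s → Fibre f s ↔ Fin (c s)

suc-fibres : {A : Set} {f : A → ℕ} {c : ℕ → ℕ} →
             f HasFibreSizes c → (λ a → suc (f a)) HasFibreSizes shift 0 c
suc-fibres h zero = mk↔ₛ′ (λ { (_ , ()) }) (λ ()) (λ ()) (λ { (_ , ()) })
suc-fibres {f = f} h (suc s) = ↔-trans pred-fibre (h s)
  where
  pred-fibre : Fibre (λ a → suc (f a)) (suc s) ↔ Fibre f s
  pred-fibre = mk↔ₛ′ (λ { (a , refl) → a , refl }) (λ { (a , refl) → a , refl })
                     (λ { (a , refl) → refl }) (λ { (a , refl) → refl })

bit-fibres : {A : Set} {f : A → ℕ} {c : ℕ → ℕ} (b : Bool) → f HasFibreSizes c →
             (λ a → (if b then 1 else 0) ℕ.+ f a) HasFibreSizes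
             (λ s → if b then shift 0 c s else c s)
bit-fibres false h = h
bit-fibres true h = suc-fibres h

nil-fibres : {A : Set} {f : Vec A 0 → ℕ} → f [] ≡ 0 → f HasFibreSizes δ
nil-fibres e zero = mk↔ₛ′ (λ _ → zero) (λ { zero → [] , e }) (λ { zero → refl })
                          (λ { ([] , p) → cong ([] ,_) (ℕ.≡-irrelevant e p) })
nil-fibres {f = f} e (suc s) = mk↔ₛ′ impossible (λ ()) (λ ()) (λ x → impossible x)
  where
  impossible : {B : Set} → Fibre f (suc s) → B
  impossible ([] , p) = contradiction (trans (sym e) p) ℕ.0≢1+n

Σ-Fin↔ : ∀ {m} {B : Fin m → Set} {c : Fin m → ℕ} →
         (∀ y → B y ↔ Fin (c y)) → Σ (Fin m) B ↔ Fin (sum c)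
Σ-Fin↔ {zero} h = mk↔ₛ′ (λ { (() , _) }) (λ ()) (λ ()) (λ { (() , _) })
Σ-Fin↔ {suc m} {B} h =
  ↔-trans split (↔-trans (h zero ⊎-↔ Σ-Fin↔ (λ y → h (suc y))) (↔-sym +↔⊎))
  where
  split : Σ (Fin (suc m)) B ↔ (B zero ⊎ Σ (Fin m) (λ y → B (suc y)))
  split = mk↔ₛ′ (λ { (zero , b) → inj₁ b ; (suc y , b) → inj₂ (y , b) })
                (λ { (inj₁ b) → zero , b ; (inj₂ (y , b)) → suc y , b })
                (λ { (inj₁ b) → refl ; (inj₂ (y , b)) → refl })
                (λ { (zero , b) → refl ; (suc y , b) → refl })

cons-fibres : ∀ {m n} {f : Vec (Fin m) (suc n) → ℕ} {c : Fin m → ℕ → ℕ} →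
              (∀ y → (λ w → f (y ∷ w)) HasFibreSizes c y) →
              f HasFibreSizes (λ s → sum (λ y → c y s))
cons-fibres {m} {f = f} h s = ↔-trans uncons (Σ-Fin↔ (λ y → h y s))
  where
  uncons : Fibre f s ↔ Σ (Fin m) (λ y → Fibre (λ w → f (y ∷ w)) s)
  uncons = mk↔ₛ′ (λ { (y ∷ w , p) → y , w , p }) (λ { (y , w , p) → y ∷ w , p })
                 (λ { (y , w , p) → refl }) (λ { (y ∷ w , p) → refl })

pos-sum : ∀ {m} (f : Fin m → ℕ) → + sum f ≡ sumℤ (λ y → + f y)
pos-sum {zero} f = refl
pos-sum {suc m} f =
  trans (ℤ.pos-+ (f zero) _) (cong (_+_ (+ f zero)) (pos-sum (λ y → f (suc y))))

sumℤ-indicator : ∀ {m} t (a b : ℤ) → t ≤ m →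
                 sumℤ {m} (λ y → if toℕ y <ᵇ t then a else b) ≡ + t * a + + (m ∸ t) * b
sumℤ-indicator {zero} zero a b _ = none a b
  where
  none : ∀ a b → 0ℤ ≡ 0ℤ * a + 0ℤ * b
  none = solve-∀
sumℤ-indicator {suc m} zero a b _ =
  trans (cong (_+_ b) (sumℤ-indicator {m} zero a b z≤n)) (one-more-b a b (+ m))
  where
  one-more-b : ∀ a b m → b + (0ℤ * a + m * b) ≡ 0ℤ * a + (1ℤ + m) * b
  one-more-b = solve-∀
sumℤ-indicator {suc m} (suc t) a b (s≤s t≤m) =
  trans (cong (_+_ a) (sumℤ-indicator {m} t a b t≤m)) (one-more-a a b (+ t) (+ (m ∸ t)))
  where
  one-more-a : ∀ a b t r → a + (t * a + r * b) ≡ (1ℤ + t) * a + r * b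
  one-more-a = solve-∀

⌊suc≟suc⌋ : ∀ {m} (x y : Fin m) → ⌊ suc x ≟ suc y ⌋ ≡ ⌊ x ≟ y ⌋
⌊suc≟suc⌋ x y with x ≟ y
... | yes _ = refl
... | no _ = refl

sumℤ-update : ∀ {m} (x : Fin m) (g f : Fin m → ℤ) →
              sumℤ (λ y → if ⌊ x ≟ y ⌋ then g y else f y) ≡ sumℤ f - f x + g x
sumℤ-update zero g f = reorder (g zero) (f zero) (sumℤ (λ y → f (suc y)))
  where
  reorder : ∀ a b c → a + c ≡ b + c - b + a
  reorder = solve-∀
sumℤ-update {suc m} (suc x) g f = begin
  f zero + sumℤ (λ y → if ⌊ suc x ≟ suc y ⌋ then g (suc y) else f (suc y))
    ≡⟨ cong (_+_ (f zero))
            (sumℤ-cong (λ y → cong (if_then g (suc y) else f (suc y)) (⌊suc≟suc⌋ x y))) ⟩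
  f zero + sumℤ (λ y → if ⌊ x ≟ y ⌋ then g (suc y) else f (suc y))
    ≡⟨ cong (_+_ (f zero)) (sumℤ-update x (λ y → g (suc y)) (λ y → f (suc y))) ⟩
  f zero + (sumℤ (λ y → f (suc y)) - f (suc x) + g (suc x))
    ≡⟨ reassoc (f zero) _ _ _ ⟩
  f zero + sumℤ (λ y → f (suc y)) - f (suc x) + g (suc x) ∎
  where
  open ≡-Reasoning
  reassoc : ∀ a b c d → a + (b - c + d) ≡ a + b - c + d
  reassoc = solve-∀

module Counting (k t : ℕ) where

  inT : Fin k → Bool
  inT x = toℕ x <ᵇ t

  isLevel : Fin k → Fin k → Bool
  isLevel x y = ⌊ x ≟ y ⌋ ∧ inT x

  countFrom : ℕ → Fin k → ℕ → ℕ
  countFrom zero x = δ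
  countFrom (suc n) x s =
    sum (λ y → if isLevel x y then shift 0 (countFrom n y) s else countFrom n y s)

  count : ℕ → ℕ → ℕ
  count zero = δ
  count (suc n) s = sum (λ x → countFrom n x s)

  countFrom-fibres : ∀ n x →
    (λ (w : Vec (Fin k) n) → levT t (x ∷ w)) HasFibreSizes countFrom n x
  countFrom-fibres zero x = nil-fibres refl
  countFrom-fibres (suc n) x =
    cons-fibres (λ y → bit-fibres (isLevel x y) (countFrom-fibres n y))

  levT-fibres : ∀ n → levT {k} {n} t HasFibreSizes count n
  levT-fibres zero = nil-fibres refl
  levT-fibres (suc n) = cons-fibres (countFrom-fibres n)

  module _ (t≤k : t ≤ k) (a b : ℕ → ℕ → ℤ)
    (a-zero : ∀ s → a 0 s ≡ + δ s) (b-zero : ∀ s → b 0 s ≡ + δ s)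
    (a-suc : ∀ n s → a (suc n) s ≡ shift 0ℤ (a n) s + (+ t - 1ℤ) * a n s + (+ k - + t) * b n s)
    (b-suc : ∀ n s → b (suc n) s ≡ + t * a n s + (+ k - + t) * b n s) where

    predicted : ℕ → Fin k → ℕ → ℤ
    predicted n x s = if inT x then a n s else b n s

    sum-predicted : ∀ n s → sumℤ (λ y → predicted n y s) ≡ + t * a n s + (+ k - + t) * b n s
    sum-predicted n s = trans (sumℤ-indicator t (a n s) (b n s) t≤k)
                              (cong (λ u → + t * a n s + u * b n s) k∸t≡k-t)
      where
      k∸t≡k-t : + (k ∸ t) ≡ + k - + t
      k∸t≡k-t = trans (sym (ℤ.⊖-≥ t≤k)) (sym (ℤ.m-n≡m⊖n k t))

    predicted-suc : ∀ n x s →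
      sumℤ (λ y → if ⌊ x ≟ y ⌋ ∧ inT x then shift 0ℤ (predicted n y) s else predicted n y s) ≡
      (if inT x then a (suc n) s else b (suc n) s)
    predicted-suc n x s with inT x in x∈t
    ... | false = begin
      sumℤ (λ y → if ⌊ x ≟ y ⌋ ∧ false then shift 0ℤ (predicted n y) s else predicted n y s)
        ≡⟨ sumℤ-cong (λ y → cong (if_then shift 0ℤ (predicted n y) s else predicted n y s)
                                 (∧-zeroʳ ⌊ x ≟ y ⌋)) ⟩
      sumℤ (λ y → predicted n y s)         ≡⟨ sum-predicted n s ⟩
      + t * a n s + (+ k - + t) * b n s    ≡⟨ sym (b-suc n s) ⟩
      b (suc n) s                          ∎
      where open ≡-Reasoning
    ... | true = begin
      sumℤ (λ y → if ⌊ x ≟ y ⌋ ∧ true then shift 0ℤ (predicted n y) s else predicted n y s)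
        ≡⟨ sumℤ-cong (λ y → cong (if_then shift 0ℤ (predicted n y) s else predicted n y s)
                                 (∧-identityʳ ⌊ x ≟ y ⌋)) ⟩
      sumℤ (λ y → if ⌊ x ≟ y ⌋ then shift 0ℤ (predicted n y) s else predicted n y s)
        ≡⟨ sumℤ-update x (λ y → shift 0ℤ (predicted n y) s) (λ y → predicted n y s) ⟩
      sumℤ (λ y → predicted n y s) - predicted n x s + shift 0ℤ (predicted n x) s
        ≡⟨ cong₂ (λ p q → sumℤ (λ y → predicted n y s) - p + q)
                 (predicted≡a s) (shift-cong predicted≡a s) ⟩
      sumℤ (λ y → predicted n y s) - a n s + shift 0ℤ (a n) s
        ≡⟨ cong (λ p → p - a n s + shift 0ℤ (a n) s) (sum-predicted n s) ⟩
      + t * a n s + (+ k - + t) * b n s - a n s + shift 0ℤ (a n) s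
        ≡⟨ regroup (shift 0ℤ (a n) s) (+ t) (a n s) (+ k - + t) (b n s) ⟩
      shift 0ℤ (a n) s + (+ t - 1ℤ) * a n s + (+ k - + t) * b n s
        ≡⟨ sym (a-suc n s) ⟩
      a (suc n) s ∎
      where
      open ≡-Reasoning
      predicted≡a : ∀ s → predicted n x s ≡ a n s
      predicted≡a s rewrite x∈t = refl
      regroup : ∀ c t a u b → t * a + u * b - a + c ≡ c + (t - 1ℤ) * a + u * b
      regroup = solve-∀

    countFrom≡predicted : ∀ n x s → + countFrom n x s ≡ predicted n x s
    countFrom≡predicted zero x s with inT x
    ... | true = sym (a-zero s)
    ... | false = sym (b-zero s)
    countFrom≡predicted (suc n) x s =
      trans (pos-sum {k} _)
            (trans (sumℤ-cong (λ y → pos-step (isLevel x y) y)) (predicted-suc n x s))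
      where
      pos-step : ∀ β y → + (if β then shift 0 (countFrom n y) s else countFrom n y s) ≡
                         (if β then shift 0ℤ (predicted n y) s else predicted n y s)
      pos-step true y = pos-shift (countFrom≡predicted n y) s
      pos-step false y = countFrom≡predicted n y s

    count≡b : ∀ n s → + count n s ≡ b n s
    count≡b zero s = sym (b-zero s)
    count≡b (suc n) s = begin
      + count (suc n) s                    ≡⟨ pos-sum {k} _ ⟩
      sumℤ (λ x → + countFrom n x s)       ≡⟨ sumℤ-cong (λ x → countFrom≡predicted n x s) ⟩
      sumℤ (λ x → predicted n x s)         ≡⟨ sum-predicted n s ⟩
      + t * a n s + (+ k - + t) * b n s    ≡⟨ sym (b-suc n s) ⟩
      b (suc n) s                          ∎
      where open ≡-Reasoning

sumTo-cong : ∀ n {f g : ℕ → ℤ} → (∀ i → i ≤ n → f i ≡ g i) → sumTo n f ≡ sumTo n g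
sumTo-cong zero e = e 0 z≤n
sumTo-cong (suc n) e =
  cong₂ _+_ (sumTo-cong n (λ i i≤n → e i (ℕ.m≤n⇒m≤1+n i≤n))) (e (suc n) ℕ.≤-refl)

sumTo-+ : ∀ n (f g : ℕ → ℤ) → sumTo n (λ i → f i + g i) ≡ sumTo n f + sumTo n g
sumTo-+ zero f g = refl
sumTo-+ (suc n) f g = trans (cong (_+ (f (suc n) + g (suc n))) (sumTo-+ n f g))
                            (interchange (sumTo n f) (sumTo n g) (f (suc n)) (g (suc n)))
  where
  interchange : ∀ a b c d → a + b + (c + d) ≡ a + c + (b + d)
  interchange = solve-∀

sumTo-minus : ∀ n (f g : ℕ → ℤ) → sumTo n (λ i → f i - g i) ≡ sumTo n f - sumTo n g
sumTo-minus zero f g = refl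
sumTo-minus (suc n) f g = trans (cong (_+ (f (suc n) - g (suc n))) (sumTo-minus n f g))
                            (interchange (sumTo n f) (sumTo n g) (f (suc n)) (g (suc n)))
  where
  interchange : ∀ a b c d → a - b + (c - d) ≡ a + c - (b + d)
  interchange = solve-∀

sumTo-* : ∀ n c (f : ℕ → ℤ) → sumTo n (λ i → c * f i) ≡ c * sumTo n f
sumTo-* zero c f = refl
sumTo-* (suc n) c f = trans (cong (_+ c * f (suc n)) (sumTo-* n c f))
                            (sym (ℤ.*-distribˡ-+ c (sumTo n f) (f (suc n))))

sumTo-suc : ∀ n (f : ℕ → ℤ) → sumTo (suc n) f ≡ f 0 + sumTo n (λ i → f (suc i))
sumTo-suc zero f = refl
sumTo-suc (suc n) f = trans (cong (_+ f (suc (suc n))) (sumTo-suc n f)) (ℤ.+-assoc (f 0) _ _)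

sumTo-extend : ∀ n (f : ℕ → ℤ) → f (suc n) ≡ 0ℤ → sumTo (suc n) f ≡ sumTo n f
sumTo-extend n f f0 = trans (cong (_+_ (sumTo n f)) f0) (ℤ.+-identityʳ (sumTo n f))

sumTo-reverse : ∀ n (f : ℕ → ℤ) → sumTo n f ≡ sumTo n (λ i → f (n ∸ i))
sumTo-reverse zero f = refl
sumTo-reverse (suc n) f = begin
  sumTo n f + f (suc n)                  ≡⟨ cong (_+ f (suc n)) (sumTo-reverse n f) ⟩
  sumTo n (λ i → f (n ∸ i)) + f (suc n)  ≡⟨ ℤ.+-comm _ (f (suc n)) ⟩
  f (suc n) + sumTo n (λ i → f (n ∸ i))  ≡⟨ sym (sumTo-suc n (λ i → f (suc n ∸ i))) ⟩
  sumTo (suc n) (λ i → f (suc n ∸ i))    ∎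
  where open ≡-Reasoning

[k+1]*[n+1]C[k+1]≡[n+1]*nCk : ∀ n k → suc k ℕ.* (suc n C suc k) ≡ suc n ℕ.* (n C k)
[k+1]*[n+1]C[k+1]≡[n+1]*nCk n zero =
  trans (ℕ.+-identityʳ _) (trans (nC1≡n (suc n)) (sym (ℕ.*-identityʳ (suc n))))
[k+1]*[n+1]C[k+1]≡[n+1]*nCk zero (suc k) = ℕ.*-zeroʳ (suc (suc k))
[k+1]*[n+1]C[k+1]≡[n+1]*nCk (suc n) (suc k) = begin
  suc (suc k) ℕ.* (suc (suc n) C suc (suc k))
    ≡⟨ cong (suc (suc k) ℕ.*_) (sym (nCk+nC[k+1]≡[n+1]C[k+1] (suc n) (suc k))) ⟩
  suc (suc k) ℕ.* (suc n C suc k ℕ.+ suc n C suc (suc k))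
    ≡⟨ expand (suc k) (suc n C suc k) _ ⟩
  suc n C suc k ℕ.+ suc k ℕ.* (suc n C suc k) ℕ.+ suc (suc k) ℕ.* (suc n C suc (suc k))
    ≡⟨ cong₂ (λ p q → suc n C suc k ℕ.+ p ℕ.+ q)
             ([k+1]*[n+1]C[k+1]≡[n+1]*nCk n k) ([k+1]*[n+1]C[k+1]≡[n+1]*nCk n (suc k)) ⟩
  suc n C suc k ℕ.+ suc n ℕ.* (n C k) ℕ.+ suc n ℕ.* (n C suc k)
    ≡⟨ collect (suc n) (n C k) (n C suc k) (suc n C suc k) ⟩
  suc n C suc k ℕ.+ suc n ℕ.* (n C k ℕ.+ n C suc k)
    ≡⟨ cong (λ c → suc n C suc k ℕ.+ suc n ℕ.* c) (nCk+nC[k+1]≡[n+1]C[k+1] n k) ⟩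
  suc (suc n) ℕ.* (suc n C suc k) ∎
  where
  open ≡-Reasoning
  expand : ∀ k a b → suc k ℕ.* (a ℕ.+ b) ≡ a ℕ.+ k ℕ.* a ℕ.+ suc k ℕ.* b
  expand = ℕ-solve-∀
  collect : ∀ n a b c → c ℕ.+ n ℕ.* a ℕ.+ n ℕ.* b ≡ c ℕ.+ n ℕ.* (a ℕ.+ b)
  collect = ℕ-solve-∀

falling-+ : ∀ m i → falling (+ m) i ≡ + ((m C i) ℕ.* i !)
falling-+ m zero = refl
falling-+ zero (suc i) = ℤ.*-zeroˡ (falling (+ 0 - + 1) i)
falling-+ (suc m) (suc i) = begin
  + suc m * falling (+ suc m - + 1) i
    ≡⟨ cong (λ z → + suc m * falling z i) (ℤ.m-n≡m⊖n (suc m) 1) ⟩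
  + suc m * falling (+ m) i
    ≡⟨ cong (+ suc m *_) (falling-+ m i) ⟩
  + suc m * + ((m C i) ℕ.* i !)
    ≡⟨ sym (ℤ.pos-* (suc m) _) ⟩
  + (suc m ℕ.* ((m C i) ℕ.* i !))
    ≡⟨ cong +_ (assoc (suc m) (m C i) (i !)) ⟩
  + (suc m ℕ.* (m C i) ℕ.* i !)
    ≡⟨ cong (λ c → + (c ℕ.* i !)) (sym ([k+1]*[n+1]C[k+1]≡[n+1]*nCk m i)) ⟩
  + (suc i ℕ.* (suc m C suc i) ℕ.* i !)
    ≡⟨ cong +_ (rotate (suc i) (suc m C suc i) (i !)) ⟩
  + ((suc m C suc i) ℕ.* (suc i ℕ.* i !)) ∎
  where
  open ≡-Reasoning
  assoc : ∀ a b c → a ℕ.* (b ℕ.* c) ≡ a ℕ.* b ℕ.* c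
  assoc = ℕ-solve-∀
  rotate : ∀ a b c → a ℕ.* b ℕ.* c ≡ b ℕ.* (a ℕ.* c)
  rotate = ℕ-solve-∀

binom-+ : ∀ m i → binom (+ m) i ≡ + (m C i)
binom-+ m i = begin
  (falling (+ m) i / + (i !)) {{i !≢0}}
    ≡⟨ cong (λ z → (z / + (i !)) {{i !≢0}}) (falling-+ m i) ⟩
  (+ ((m C i) ℕ.* i !) / + (i !)) {{i !≢0}}
    ≡⟨ div-pos-is-/ℕ (+ ((m C i) ℕ.* i !)) (i !) {{i !≢0}} ⟩
  + (((m C i) ℕ.* i !) ℕ./ i !) {{i !≢0}}
    ≡⟨ cong +_ (m*n/n≡m (m C i) (i !) {{i !≢0}}) ⟩
  + (m C i) ∎
  where open ≡-Reasoning

-- the number of multisets of size j from i kinds; truncated subtraction is harmless,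
-- as (0 ∸ 1) C 0 = 1 agrees with C(−1, 0) = 1
multichoose : ℕ → ℕ → ℕ
multichoose i j = (i ℕ.+ j ∸ 1) C j

multichoose-pascal : ∀ i j →
  multichoose (suc i) (suc j) ≡ multichoose (suc i) j ℕ.+ multichoose i (suc j)
multichoose-pascal i j rewrite ℕ.+-suc i j = sym (nCk+nC[k+1]≡[n+1]C[k+1] (i ℕ.+ j) j)

multichoose-zero : ∀ j → multichoose 0 (suc j) ≡ 0
multichoose-zero j = k>n⇒nCk≡0 (ℕ.n<1+n j)

binom-multichoose : ∀ i j → binom (+ i + + j - + 1) j ≡ + multichoose i j
binom-multichoose i zero = refl
binom-multichoose i (suc j) rewrite ℕ.+-suc i j =
  trans (cong (λ z → binom z (suc j)) (ℤ.m-n≡m⊖n (suc (i ℕ.+ j)) 1))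
        (binom-+ (i ℕ.+ j) (suc j))

-- the coefficient of x^s in (x − 1)^j
signedC : ℕ → ℕ → ℤ
signedC j s = (- + 1) ^ (j ℕ.+ s) * + (j C s)

signedC-suc : ∀ j s → signedC (suc j) s ≡ shift 0ℤ (signedC j) s - signedC j s
signedC-suc j zero = negate ((- + 1) ^ (j ℕ.+ 0))
  where
  negate : ∀ x → (- + 1) * x * + 1 ≡ 0ℤ - x * + 1
  negate = solve-∀
signedC-suc j (suc s) rewrite ℕ.+-suc j s =
  trans (cong ((- + 1) * ((- + 1) * (- + 1) ^ (j ℕ.+ s)) *_)
              (trans (cong +_ (sym (nCk+nC[k+1]≡[n+1]C[k+1] j s))) (ℤ.pos-+ (j C s) (j C suc s))))
        (split ((- + 1) ^ (j ℕ.+ s)) (+ (j C s)) (+ (j C suc s)))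
  where
  split : ∀ x a b → (- + 1) * ((- + 1) * x) * (a + b) ≡ x * a - (- + 1) * x * b
  split = solve-∀

-- If φ lists the coefficients of a polynomial p(w) of degree ≤ n, then
-- translate n φ lists those of p(x − 1).
translate : ℕ → (ℕ → ℤ) → ℕ → ℤ
translate n φ s = sumTo n (λ j → signedC j s * φ j)

translate-δ : ∀ s → translate 0 (λ j → + δ j) s ≡ + δ s
translate-δ zero = refl
translate-δ (suc s) = trans (ℤ.*-identityʳ _) (ℤ.*-zeroʳ ((- + 1) ^ suc s))

translate-+ : ∀ n (φ ψ : ℕ → ℤ) s →
              translate n (λ j → φ j + ψ j) s ≡ translate n φ s + translate n ψ s
translate-+ n φ ψ s =
  trans (sumTo-cong n (λ j _ → ℤ.*-distribˡ-+ (signedC j s) (φ j) (ψ j))) (sumTo-+ n _ _)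

translate-* : ∀ n c (φ : ℕ → ℤ) s →
              translate n (λ j → c * φ j) s ≡ c * translate n φ s
translate-* n c φ s = trans (sumTo-cong n (λ j _ → swap (signedC j s) c (φ j))) (sumTo-* n c _)
  where
  swap : ∀ a c x → a * (c * x) ≡ c * (a * x)
  swap = solve-∀

translate-linear : ∀ n a b (φ ψ : ℕ → ℤ) s →
  translate n (λ j → a * φ j + b * ψ j) s ≡ a * translate n φ s + b * translate n ψ s
translate-linear n a b φ ψ s =
  trans (translate-+ n _ _ s) (cong₂ _+_ (translate-* n a φ s) (translate-* n b ψ s))

translate-extend : ∀ n (φ : ℕ → ℤ) s →
                   φ (suc n) ≡ 0ℤ → translate (suc n) φ s ≡ translate n φ s
translate-extend n φ s φ0 =
  sumTo-extend n _ (trans (cong (signedC (suc n) s *_) φ0) (ℤ.*-zeroʳ (signedC (suc n) s)))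

translate-shift : ∀ n (φ : ℕ → ℤ) s →
  translate (suc n) (shift 0ℤ φ) s ≡ shift 0ℤ (translate n φ) s - translate n φ s
translate-shift n φ s = begin
  translate (suc n) (shift 0ℤ φ) s
    ≡⟨ sumTo-suc n _ ⟩
  signedC 0 s * 0ℤ + sumTo n (λ j → signedC (suc j) s * φ j)
    ≡⟨ drop-zero (signedC 0 s) _ ⟩
  sumTo n (λ j → signedC (suc j) s * φ j)
    ≡⟨ sumTo-cong n (λ j _ → signedC-suc-* j) ⟩
  sumTo n (λ j → shift 0ℤ (signedC j) s * φ j - signedC j s * φ j)
    ≡⟨ sumTo-minus n _ _ ⟩
  sumTo n (λ j → shift 0ℤ (signedC j) s * φ j) - translate n φ s
    ≡⟨ cong (_- translate n φ s) (shifted s) ⟩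
  shift 0ℤ (translate n φ) s - translate n φ s ∎
  where
  open ≡-Reasoning
  drop-zero : ∀ a b → a * 0ℤ + b ≡ b
  drop-zero = solve-∀
  distrib : ∀ a b c → (a - b) * c ≡ a * c - b * c
  distrib = solve-∀
  signedC-suc-* : ∀ j →
    signedC (suc j) s * φ j ≡ shift 0ℤ (signedC j) s * φ j - signedC j s * φ j
  signedC-suc-* j =
    trans (cong (_* φ j) (signedC-suc j s)) (distrib (shift 0ℤ (signedC j) s) (signedC j s) (φ j))
  shifted : ∀ s → sumTo n (λ j → shift 0ℤ (signedC j) s * φ j) ≡ shift 0ℤ (translate n φ) s
  shifted zero = trans (sumTo-* n 0ℤ φ) (ℤ.*-zeroˡ (sumTo n φ))
  shifted (suc s) = refl

module LevelPolynomials (t u : ℤ) where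

  -- Σ_{i ≤ m} C(m, i) u^(m − i) t^i φ i, see binomialSum-expand
  binomialSum : ℕ → (ℕ → ℤ) → ℤ
  binomialSum zero φ = φ 0
  binomialSum (suc m) φ = binomialSum m (λ i → u * φ i + t * φ (suc i))

  binomialSum-cong : ∀ m {φ ψ : ℕ → ℤ} →
                     (∀ i → φ i ≡ ψ i) → binomialSum m φ ≡ binomialSum m ψ
  binomialSum-cong zero e = e 0
  binomialSum-cong (suc m) e =
    binomialSum-cong m (λ i → cong₂ (λ p q → u * p + t * q) (e i) (e (suc i)))

  binomialSum-+ : ∀ m (φ ψ : ℕ → ℤ) →
                  binomialSum m (λ i → φ i + ψ i) ≡ binomialSum m φ + binomialSum m ψ
  binomialSum-+ zero φ ψ = refl
  binomialSum-+ (suc m) φ ψ =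
    trans (binomialSum-cong m (λ i → regroup u t (φ i) (ψ i) (φ (suc i)) (ψ (suc i))))
          (binomialSum-+ m (λ i → u * φ i + t * φ (suc i)) (λ i → u * ψ i + t * ψ (suc i)))
    where
    regroup : ∀ u t a b c d → u * (a + b) + t * (c + d) ≡ (u * a + t * c) + (u * b + t * d)
    regroup = solve-∀

  binomialSum-* : ∀ m c (φ : ℕ → ℤ) → binomialSum m (λ i → c * φ i) ≡ c * binomialSum m φ
  binomialSum-* zero c φ = refl
  binomialSum-* (suc m) c φ =
    trans (binomialSum-cong m (λ i → regroup u t c (φ i) (φ (suc i))))
          (binomialSum-* m c (λ i → u * φ i + t * φ (suc i)))
    where
    regroup : ∀ u t c a b → u * (c * a) + t * (c * b) ≡ c * (u * a + t * b)
    regroup = solve-∀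

  binomialSum-linear : ∀ m a b (φ ψ : ℕ → ℤ) →
    binomialSum m (λ i → a * φ i + b * ψ i) ≡ a * binomialSum m φ + b * binomialSum m ψ
  binomialSum-linear m a b φ ψ =
    trans (binomialSum-+ m _ _) (cong₂ _+_ (binomialSum-* m a φ) (binomialSum-* m b ψ))

  binomialTerm : ℕ → (ℕ → ℤ) → ℕ → ℤ
  binomialTerm m φ i = + (m C i) * u ^ (m ∸ i) * t ^ i * φ i

  sumTo-binomialTerm-suc : ∀ m (φ : ℕ → ℤ) →
    sumTo (suc m) (binomialTerm (suc m) φ) ≡
    u * sumTo m (binomialTerm m φ) + t * sumTo m (binomialTerm m (λ i → φ (suc i)))
  sumTo-binomialTerm-suc m φ = begin
    sumTo (suc m) (binomialTerm (suc m) φ)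
      ≡⟨ sumTo-suc m _ ⟩
    V 0 + sumTo m (λ i → binomialTerm (suc m) φ (suc i))
      ≡⟨ cong (_+_ (V 0)) (sumTo-cong m (λ i _ → pascal i)) ⟩
    V 0 + sumTo m (λ i → W i + V (suc i))
      ≡⟨ cong (_+_ (V 0)) (sumTo-+ m W (λ i → V (suc i))) ⟩
    V 0 + (sumTo m W + sumTo m (λ i → V (suc i)))
      ≡⟨ swap (V 0) (sumTo m W) _ ⟩
    V 0 + sumTo m (λ i → V (suc i)) + sumTo m W
      ≡⟨ cong (_+ sumTo m W) (sym (sumTo-suc m V)) ⟩
    sumTo (suc m) V + sumTo m W
      ≡⟨ cong (_+ sumTo m W) (sumTo-extend m V V-top) ⟩
    sumTo m V + sumTo m W
      ≡⟨ cong₂ _+_ V-sum W-sum ⟩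
    u * sumTo m (binomialTerm m φ) + t * sumTo m (binomialTerm m (λ i → φ (suc i))) ∎
    where
    open ≡-Reasoning
    V W : ℕ → ℤ
    V i = + (m C i) * u ^ (suc m ∸ i) * t ^ i * φ i
    W i = + (m C i) * u ^ (m ∸ i) * t ^ suc i * φ (suc i)
    swap : ∀ a b c → a + (b + c) ≡ (a + c) + b
    swap = solve-∀
    split : ∀ a b x y z → (a + b) * x * y * z ≡ a * x * y * z + b * x * y * z
    split = solve-∀
    pascal : ∀ i → binomialTerm (suc m) φ (suc i) ≡ W i + V (suc i)
    pascal i = trans (cong (λ c → c * u ^ (m ∸ i) * t ^ suc i * φ (suc i))
                           (trans (cong +_ (sym (nCk+nC[k+1]≡[n+1]C[k+1] m i))) (ℤ.pos-+ (m C i) _)))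
                     (split (+ (m C i)) (+ (m C suc i)) (u ^ (m ∸ i)) (t ^ suc i) (φ (suc i)))
    annihilate : ∀ x y z → 0ℤ * x * y * z ≡ 0ℤ
    annihilate = solve-∀
    V-top : V (suc m) ≡ 0ℤ
    V-top rewrite k>n⇒nCk≡0 (ℕ.n<1+n m) =
      annihilate (u ^ (suc m ∸ suc m)) (t ^ suc m) (φ (suc m))
    pull-u : ∀ u a x y z → a * (u * x) * y * z ≡ u * (a * x * y * z)
    pull-u = solve-∀
    V-sum : sumTo m V ≡ u * sumTo m (binomialTerm m φ)
    V-sum = trans (sumTo-cong m (λ i i≤m →
                    trans (cong (λ e → + (m C i) * u ^ e * t ^ i * φ i) (ℕ.+-∸-assoc 1 i≤m))
                          (pull-u u (+ (m C i)) (u ^ (m ∸ i)) (t ^ i) (φ i))))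
                  (sumTo-* m u _)
    pull-t : ∀ t a x y z → a * x * (t * y) * z ≡ t * (a * x * y * z)
    pull-t = solve-∀
    W-sum : sumTo m W ≡ t * sumTo m (binomialTerm m (λ i → φ (suc i)))
    W-sum = trans (sumTo-cong m (λ i _ →
                    pull-t t (+ (m C i)) (u ^ (m ∸ i)) (t ^ i) (φ (suc i))))
                  (sumTo-* m t _)

  binomialSum-expand : ∀ m (φ : ℕ → ℤ) → sumTo m (binomialTerm m φ) ≡ binomialSum m φ
  binomialSum-expand zero φ = ℤ.*-identityˡ (φ 0)
  binomialSum-expand (suc m) φ = begin
    sumTo (suc m) (binomialTerm (suc m) φ)
      ≡⟨ sumTo-binomialTerm-suc m φ ⟩
    u * sumTo m (binomialTerm m φ) + t * sumTo m (binomialTerm m (λ i → φ (suc i)))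
      ≡⟨ cong₂ (λ p q → u * p + t * q)
               (binomialSum-expand m φ) (binomialSum-expand m (λ i → φ (suc i))) ⟩
    u * binomialSum m φ + t * binomialSum m (λ i → φ (suc i))
      ≡⟨ sym (binomialSum-linear m u t φ (λ i → φ (suc i))) ⟩
    binomialSum (suc m) φ ∎
    where open ≡-Reasoning

  -- With t = |[t]| and u = k − t, A n and B n are the coefficient sequences, in w = x − 1,
  -- of Σ x^lev over the words of length n + 1 with a fixed first letter in [t], resp. over
  -- all words of length n.
  A B : ℕ → ℕ → ℤ
  A zero j = + δ j
  A (suc n) j = shift 0ℤ (A n) j + (u * B n j + t * A n j)
  B zero j = + δ j
  B (suc n) j = u * B n j + t * A n j

  zero-combination : ∀ a b → a * 0ℤ + b * 0ℤ ≡ 0ℤ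
  zero-combination = solve-∀

  A-vanishes : ∀ {n j} → n < j → A n j ≡ 0ℤ
  B-vanishes : ∀ {n j} → n < j → B n j ≡ 0ℤ
  A-vanishes {zero} {suc j} _ = refl
  A-vanishes {suc n} {suc j} (s≤s n<j)
    rewrite A-vanishes n<j | A-vanishes (ℕ.m<n⇒m<1+n n<j) | B-vanishes (ℕ.m<n⇒m<1+n n<j) =
    cong (_+_ 0ℤ) (zero-combination u t)
  B-vanishes {zero} {suc j} _ = refl
  B-vanishes {suc n} {suc j} (s≤s n<j)
    rewrite A-vanishes (ℕ.m<n⇒m<1+n n<j) | B-vanishes (ℕ.m<n⇒m<1+n n<j) =
    zero-combination u t

  A-diagonal : ∀ j → A j j ≡ 1ℤ
  A-diagonal zero = refl
  A-diagonal (suc j)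
    rewrite A-diagonal j | A-vanishes (ℕ.n<1+n j) | B-vanishes (ℕ.n<1+n j) =
    cong (_+_ 1ℤ) (zero-combination u t)

  A-closed : ∀ m j → A (m ℕ.+ j) j ≡ binomialSum m (λ i → + multichoose (suc i) j)
  B-closed : ∀ m j → B (m ℕ.+ j) j ≡ binomialSum m (λ i → + multichoose i j)
  A-closed zero j = trans (A-diagonal j) (cong +_ (sym (nCn≡1 j)))
  A-closed (suc m) zero = begin
    0ℤ + (u * B (m ℕ.+ 0) 0 + t * A (m ℕ.+ 0) 0)
      ≡⟨ ℤ.+-identityˡ _ ⟩
    u * B (m ℕ.+ 0) 0 + t * A (m ℕ.+ 0) 0
      ≡⟨ cong₂ (λ p q → u * p + t * q) (B-closed m 0) (A-closed m 0) ⟩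
    u * binomialSum m (λ _ → 1ℤ) + t * binomialSum m (λ _ → 1ℤ)
      ≡⟨ sym (binomialSum-linear m u t _ _) ⟩
    binomialSum (suc m) (λ _ → 1ℤ) ∎
    where open ≡-Reasoning
  A-closed (suc m) (suc j) = begin
    A (m ℕ.+ suc j) j + (u * B (m ℕ.+ suc j) (suc j) + t * A (m ℕ.+ suc j) (suc j))
      ≡⟨ cong₂ _+_ (trans (cong (λ n → A n j) (ℕ.+-suc m j)) (A-closed (suc m) j))
                   (cong₂ (λ p q → u * p + t * q) (B-closed m (suc j)) (A-closed m (suc j))) ⟩
    binomialSum (suc m) (λ i → M (suc i) j) +
      (u * binomialSum m (λ i → M i (suc j)) + t * binomialSum m (λ i → M (suc i) (suc j)))
      ≡⟨ cong (_+_ (binomialSum (suc m) (λ i → M (suc i) j)))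
              (sym (binomialSum-linear m u t _ _)) ⟩
    binomialSum m (λ i → u * M (suc i) j + t * M (suc (suc i)) j) +
      binomialSum m (λ i → u * M i (suc j) + t * M (suc i) (suc j))
      ≡⟨ sym (binomialSum-+ m _ _) ⟩
    binomialSum m (λ i → (u * M (suc i) j + t * M (suc (suc i)) j) +
                         (u * M i (suc j) + t * M (suc i) (suc j)))
      ≡⟨ binomialSum-cong m (λ i → sym (pascal i)) ⟩
    binomialSum (suc m) (λ i → M (suc i) (suc j)) ∎
    where
    open ≡-Reasoning
    M : ℕ → ℕ → ℤ
    M i j = + multichoose i j
    M-pascal : ∀ i → M (suc i) (suc j) ≡ M (suc i) j + M i (suc j)
    M-pascal i = trans (cong +_ (multichoose-pascal i j)) (ℤ.pos-+ (multichoose (suc i) j) _)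
    regroup : ∀ u t a b c d → u * (a + b) + t * (c + d) ≡ (u * a + t * c) + (u * b + t * d)
    regroup = solve-∀
    pascal : ∀ i → u * M (suc i) (suc j) + t * M (suc (suc i)) (suc j) ≡
                   (u * M (suc i) j + t * M (suc (suc i)) j) +
                   (u * M i (suc j) + t * M (suc i) (suc j))
    pascal i = trans (cong₂ (λ p q → u * p + t * q) (M-pascal i) (M-pascal (suc i)))
                     (regroup u t _ _ _ _)
  B-closed zero zero = refl
  B-closed zero (suc j)
    rewrite multichoose-zero j | A-vanishes (ℕ.n<1+n j) | B-vanishes (ℕ.n<1+n j) =
    zero-combination u t
  B-closed (suc m) j = trans (cong₂ (λ p q → u * p + t * q) (B-closed m j) (A-closed m j))
                             (sym (binomialSum-linear m u t _ _))

  Aˣ Bˣ : ℕ → ℕ → ℤ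
  Aˣ n = translate n (A n)
  Bˣ n = translate n (B n)

  Aˣ-extend : ∀ n s → translate (suc n) (A n) s ≡ Aˣ n s
  Aˣ-extend n s = translate-extend n (A n) s (A-vanishes (ℕ.n<1+n n))

  Bˣ-extend : ∀ n s → translate (suc n) (B n) s ≡ Bˣ n s
  Bˣ-extend n s = translate-extend n (B n) s (B-vanishes (ℕ.n<1+n n))

  Aˣ-suc : ∀ n s → Aˣ (suc n) s ≡ shift 0ℤ (Aˣ n) s + (t - 1ℤ) * Aˣ n s + u * Bˣ n s
  Aˣ-suc n s = begin
    translate (suc n) (λ j → shift 0ℤ (A n) j + (u * B n j + t * A n j)) s
      ≡⟨ translate-+ (suc n) _ _ s ⟩
    translate (suc n) (shift 0ℤ (A n)) s + translate (suc n) (λ j → u * B n j + t * A n j) s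
      ≡⟨ cong₂ _+_ (translate-shift n (A n) s) (translate-linear (suc n) u t (B n) (A n) s) ⟩
    shift 0ℤ (Aˣ n) s - Aˣ n s + (u * translate (suc n) (B n) s + t * translate (suc n) (A n) s)
      ≡⟨ cong₂ (λ p q → shift 0ℤ (Aˣ n) s - Aˣ n s + (u * p + t * q))
               (Bˣ-extend n s) (Aˣ-extend n s) ⟩
    shift 0ℤ (Aˣ n) s - Aˣ n s + (u * Bˣ n s + t * Aˣ n s)
      ≡⟨ regroup (shift 0ℤ (Aˣ n) s) (Aˣ n s) (Bˣ n s) u t ⟩
    shift 0ℤ (Aˣ n) s + (t - 1ℤ) * Aˣ n s + u * Bˣ n s ∎
    where
    open ≡-Reasoning
    regroup : ∀ c a b u t → c - a + (u * b + t * a) ≡ c + (t - 1ℤ) * a + u * b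
    regroup = solve-∀

  Bˣ-suc : ∀ n s → Bˣ (suc n) s ≡ t * Aˣ n s + u * Bˣ n s
  Bˣ-suc n s = begin
    translate (suc n) (λ j → u * B n j + t * A n j) s
      ≡⟨ translate-linear (suc n) u t (B n) (A n) s ⟩
    u * translate (suc n) (B n) s + t * translate (suc n) (A n) s
      ≡⟨ cong₂ (λ p q → u * p + t * q) (Bˣ-extend n s) (Aˣ-extend n s) ⟩
    u * Bˣ n s + t * Aˣ n s
      ≡⟨ ℤ.+-comm (u * Bˣ n s) _ ⟩
    t * Aˣ n s + u * Bˣ n s ∎
    where open ≡-Reasoning

rhs≡Bˣ : ∀ k t n s → rhs k t n s ≡ LevelPolynomials.Bˣ (+ t) (+ k - + t) n s
rhs≡Bˣ k t n s = begin
  rhs k t n s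
    ≡⟨ sumTo-cong n inner ⟩
  sumTo n (λ m → signedC (n ∸ m) s * B n (n ∸ m))
    ≡⟨ sumTo-reverse n _ ⟩
  sumTo n (λ j → signedC (n ∸ (n ∸ j)) s * B n (n ∸ (n ∸ j)))
    ≡⟨ sumTo-cong n (λ j j≤n → cong (λ i → signedC i s * B n i) (ℕ.m∸[m∸n]≡n j≤n)) ⟩
  Bˣ n s ∎
  where
  open ≡-Reasoning
  open LevelPolynomials (+ t) (+ k - + t)
  regroup : ∀ e a q c x y → e * a * q * c * x * y ≡ e * c * (a * x * y * q)
  regroup = solve-∀
  inner : ∀ m → m ≤ n →
    sumTo m (λ i → (- + 1) ^ ((n ∸ m) ℕ.+ s) * binom (+ m) i
                   * binom (+ i + + (n ∸ m) - + 1) (n ∸ m) * binom (+ (n ∸ m)) s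
                   * (+ k - + t) ^ (m ∸ i) * (+ t) ^ i)
    ≡ signedC (n ∸ m) s * B n (n ∸ m)
  inner m m≤n = begin
    _ ≡⟨ sumTo-cong m (λ i _ → summand i) ⟩
    sumTo m (λ i → signedC j s * binomialTerm m (λ i → + multichoose i j) i)
      ≡⟨ sumTo-* m (signedC j s) _ ⟩
    signedC j s * sumTo m (binomialTerm m (λ i → + multichoose i j))
      ≡⟨ cong (signedC j s *_) (binomialSum-expand m _) ⟩
    signedC j s * binomialSum m (λ i → + multichoose i j)
      ≡⟨ cong (signedC j s *_) (sym (B-closed m j)) ⟩
    signedC j s * B (m ℕ.+ j) j
      ≡⟨ cong (λ n′ → signedC j s * B n′ j) (ℕ.m+[n∸m]≡n m≤n) ⟩
    signedC j s * B n j ∎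
    where
    j : ℕ
    j = n ∸ m
    summand : ∀ i → (- + 1) ^ (j ℕ.+ s) * binom (+ m) i * binom (+ i + + j - + 1) j
                    * binom (+ j) s * (+ k - + t) ^ (m ∸ i) * (+ t) ^ i
                    ≡ signedC j s * binomialTerm m (λ i → + multichoose i j) i
    summand i rewrite binom-+ m i | binom-multichoose i j | binom-+ j s =
      regroup ((- + 1) ^ (j ℕ.+ s)) (+ (m C i)) (+ multichoose i j) (+ (j C s))
              ((+ k - + t) ^ (m ∸ i)) ((+ t) ^ i)

theorem3p1 : (k t n s : ℕ) → 1 ≤ t → t ≤ k →
    ∃[ N ] ((Σ (Vec (Fin k) n) (λ π → levT t π ≡ s) ↔ Fin N) × (+ N ≡ rhs k t n s))
theorem3p1 k t n s _ t≤k =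
  count n s , levT-fibres n s ,
  trans (count≡b t≤k Aˣ Bˣ translate-δ translate-δ Aˣ-suc Bˣ-suc n s) (sym (rhs≡Bˣ k t n s))
  where
  open Counting k t
  open LevelPolynomials (+ t) (+ k - + t)
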